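{- On any LTS $(\mathbb P,Act,\rightarrow)$, the relation $\simeq_{br}$ and, for every $X\subseteq A$, the relation $\simeq^X_{br}$ are equivalence relations on $\mathbb P$.
   Context: An LTS is $(\mathbb{P},Act,\rightarrow)$ with ${\rightarrow}\subseteq\mathbb{P}\times Act\times\mathbb{P}$, $Act=A\uplus\{\tau,t\}$ ($A$ visible actions, $\tau$ hidden, $t$ time-out). $A_\tau:=A\cup\{\tau\}$. $P\xrightarrow{(\alpha)}P'$ means ($\alpha=\tau$ and $P=P'$) or $P\xrightarrow{\alpha}P'$. $\Longrightarrow$ is the reflexive-transitive closure of $\xrightarrow{\tau}$. $P\not\xrightarrow{\tau}$: $P$ has no $\tau$-transition. $\mathcal I(P):=\{\alpha\in A_\tau\mid\exists Q.\,P\xrightarrow{\alpha}Q\}$. A concrete branching reactive bisimulation is a relation $\mathcal{R}\subseteq(\mathbb{P}\times\mathbb{P})\cup(\mathbb{P}\times\mathcal{P}(A)\times\mathbb{P})$, symmetric ($\mathcal R(P,Q)\Leftrightarrow\mathcal R(Q,P)$, $\mathcal R(P,X,Q)\Leftrightarrow\mathcal R(Q,X,P)$), such that for all $P,Q,X$: 1. if $\mathcal R(P,Q)$: (a) if $P\xrightarrow{\alpha}P'$, $\alpha\in A_\tau$, there is $Q\Longrightarrow Q_1\xrightarrow{(\alpha)}Q_2$ with $\mathcal R(P,Q_1)$, $\mathcal R(P',Q_2)$; (b) $\mathcal R(P,Y,Q)$ for all $Y\subseteq A$; 2. if $\mathcal R(P,X,Q)$: (a) if $P\xrightarrow{\tau}P'$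 there is $Q\Longrightarrow Q_1\xrightarrow{(\tau)}Q_2$ with $\mathcal R(P,X,Q_1)$, $\mathcal R(P',X,Q_2)$; (b) if $P\xrightarrow{a}P'$, $a\in X$, there is $Q\Longrightarrow Q_1\xrightarrow{a}Q_2$ with $\mathcal R(P,X,Q_1)$, $\mathcal R(P',Q_2)$; (c) if $\mathcal I(P)\cap(X\cup\{\tau\})=\emptyset$ there is $Q\Longrightarrow Q_0$ with $\mathcal R(P,Q_0)$; (d) if $\mathcal I(P)\cap(X\cup\{\tau\})=\emptyset$ and $P\xrightarrow{t}P'$ there is $Q\Longrightarrow Q_1\xrightarrow{t}Q_2$ with $\mathcal R(P',X,Q_2)$; (e) if $P\not\xrightarrow{\tau}$ there is $Q\Longrightarrow Q_0$ with $Q_0\not\xrightarrow{\tau}$. $P\simeq_{br}Q$ (resp. $P\simeq^X_{br}Q$) iff $\mathcal R(P,Q)$ (resp. $\mathcal R(P,X,Q)$) for some such $\mathcal R$. -}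

module Defs where

open import Level using (Level; suc; _⊔_; 0ℓ)
open import Data.Product using (Σ; ∃; ∃-syntax; _×_; _,_)
open import Data.Sum using (_⊎_)
open import Relation.Nullary using (¬_)
open import Relation.Unary using (Pred)
open import Relation.Binary.PropositionalEquality using (_≡_; _≢_)
open import Relation.Binary.Construct.Closure.ReflexiveTransitive using (Star)

data Act (A : Set) : Set where
  vis : A → Act A
  τ   : Act A
  t   : Act A

record LTS : Set₁ where
  field
    Proc : Set
    Vis  : Set
    _⟶[_]_ : Proc → Act Vis → Proc → Set

module _ (L : LTS) where
  open LTS L

  Subset : Set₁
  Subset = Pred Vis 0ℓ

  _⟶⦅_⦆_ : Proc → Act Vis → Proc → Set
  P ⟶⦅ α ⦆ P' = (α ≡ τ × P ≡ P') ⊎ (P ⟶[ α ] P')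

  _⟶τ_ : Proc → Proc → Set
  P ⟶τ P' = P ⟶[ τ ] P'

  _⟹_ : Proc → Proc → Set
  _⟹_ = Star _⟶τ_

  Stable : Proc → Set
  Stable P = ∀ P' → ¬ (P ⟶τ P')

  NoInitIn : Subset → Proc → Set
  NoInitIn X P = Stable P × (∀ a P' → X a → ¬ (P ⟶[ vis a ] P'))

  -- A relation R ⊆ (ℙ × ℙ) ∪ (ℙ × 𝒫(A) × ℙ), given by its two components
  record Rel₂ : Set₁ where
    field
      R₀ : Proc → Proc → Set
      R₁ : Proc → Subset → Proc → Set

  record IsCBRB (ℛ : Rel₂) : Set₁ where
    open Rel₂ ℛ
    field
      sym₀ : ∀ P Q → R₀ P Q → R₀ Q P
      sym₁ : ∀ P X Q → R₁ P X Q → R₁ Q X P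
      c1a : ∀ P Q α P' → R₀ P Q → α ≢ t → P ⟶[ α ] P' →
            ∃[ Q₁ ] ∃[ Q₂ ] (Q ⟹ Q₁ × Q₁ ⟶⦅ α ⦆ Q₂ × R₀ P Q₁ × R₀ P' Q₂)
      c1b : ∀ P Q → R₀ P Q → ∀ Y → R₁ P Y Q
      c2a : ∀ P X Q P' → R₁ P X Q → P ⟶τ P' →
            ∃[ Q₁ ] ∃[ Q₂ ] (Q ⟹ Q₁ × Q₁ ⟶⦅ τ ⦆ Q₂ × R₁ P X Q₁ × R₁ P' X Q₂)
      c2b : ∀ P X Q a P' → R₁ P X Q → X a → P ⟶[ vis a ] P' →
            ∃[ Q₁ ] ∃[ Q₂ ] (Q ⟹ Q₁ × Q₁ ⟶[ vis a ] Q₂ × R₁ P X Q₁ × R₀ P' Q₂)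
      c2c : ∀ P X Q → R₁ P X Q → NoInitIn X P →
            ∃[ Q₀ ] (Q ⟹ Q₀ × R₀ P Q₀)
      c2d : ∀ P X Q P' → R₁ P X Q → NoInitIn X P → P ⟶[ t ] P' →
            ∃[ Q₁ ] ∃[ Q₂ ] (Q ⟹ Q₁ × Q₁ ⟶[ t ] Q₂ × R₁ P' X Q₂)
      c2e : ∀ P X Q → R₁ P X Q → Stable P →
            ∃[ Q₀ ] (Q ⟹ Q₀ × Stable Q₀)

  _≃br_ : Proc → Proc → Set₁
  P ≃br Q = Σ Rel₂ λ ℛ → IsCBRB ℛ × Rel₂.R₀ ℛ P Q

  _≃br[_]_ : Proc → Subset → Proc → Set₁
  P ≃br[ X ] Q = Σ Rel₂ λ ℛ → IsCBRB ℛ × Rel₂.R₁ ℛ P X Q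

-- Reflexivity is witnessed by the identity relation and symmetry is built into the definition. For
-- transitivity, compose the two witnessing relations ℛ and 𝒮 and close symmetrically: ℛ ⨾ 𝒮 ∪ 𝒮 ⨾ ℛ.
-- The transfer clauses compose by matching P's move in the middle process M, then lifting M's τ-path
-- through 𝒮. The delicate clauses are 2(c) and 2(d), where P idles but M need not: using 2(c) and 2(e)
-- for ℛ, M first moves to a stable M' with R₀ P M' (a stable P stays related along M's τ-path). Then M'
-- cannot perform any action of X either, since P would have to match it, so 2(c) and 2(d) apply to 𝒮.
module Submission where

open import Defs hiding (_⟹_; _⟶⦅_⦆_; Stable; NoInitIn)
import Defs as D
open import Data.Product using (_×_; _,_; ∃-syntax)
open import Data.Sum using (_⊎_; inj₁; inj₂)
open import Data.Empty using (⊥-elim)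
open import Relation.Binary.Structures using (IsEquivalence)
open import Relation.Binary.PropositionalEquality using (_≡_; _≢_; refl; sym; subst)
open import Relation.Binary.Construct.Closure.ReflexiveTransitive using (ε; _◅_; _◅◅_)

module _ (L : LTS) where
  open LTS L
  open Rel₂

  _⟹_ : Proc → Proc → Set
  _⟹_ = D._⟹_ L

  _⟶⦅_⦆_ : Proc → Act Vis → Proc → Set
  _⟶⦅_⦆_ = D._⟶⦅_⦆_ L

  Stable : Proc → Set
  Stable = D.Stable L

  NoInitIn : Subset L → Proc → Set
  NoInitIn = D.NoInitIn L

  τ≢t : τ {Vis} ≢ t
  τ≢t ()

  Stable⇒⟹-≡ : ∀ {P P'} → Stable P → P ⟹ P' → P ≡ P'
  Stable⇒⟹-≡ s ε       = refl
  Stable⇒⟹-≡ s (p ◅ _) = ⊥-elim (s _ p)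

  Stable⇒⟶⦅τ⦆-≡ : ∀ {P P'} → Stable P → P ⟶⦅ τ ⦆ P' → P ≡ P'
  Stable⇒⟶⦅τ⦆-≡ s (inj₁ (_ , e)) = e
  Stable⇒⟶⦅τ⦆-≡ s (inj₂ p)       = ⊥-elim (s _ p)

  ⟶⦅vis⦆⇒⟶ : ∀ {P P' a} → P ⟶⦅ vis a ⦆ P' → P ⟶[ vis a ] P'
  ⟶⦅vis⦆⇒⟶ (inj₂ p) = p

  ⟹-⟶⦅τ⦆ : ∀ {Q Q₁ Q₂} → Q ⟹ Q₁ → Q₁ ⟶⦅ τ ⦆ Q₂ → Q ⟹ Q₂
  ⟹-⟶⦅τ⦆ q (inj₁ (_ , refl)) = q
  ⟹-⟶⦅τ⦆ q (inj₂ p)          = q ◅◅ (p ◅ ε)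

  ≡-isCBRB : IsCBRB L (record { R₀ = _≡_ ; R₁ = λ P _ Q → P ≡ Q })
  ≡-isCBRB = record
    { sym₀ = λ _ _ → sym
    ; sym₁ = λ _ _ _ → sym
    ; c1a  = λ { P _ _ P' refl _ p   → P , P' , ε , inj₂ p , refl , refl }
    ; c1b  = λ { _ _ refl _          → refl }
    ; c2a  = λ { P _ _ P' refl p     → P , P' , ε , inj₂ p , refl , refl }
    ; c2b  = λ { P _ _ _ P' refl _ p → P , P' , ε , p , refl , refl }
    ; c2c  = λ { P _ _ refl _        → P , ε , refl }
    ; c2d  = λ { P _ _ P' refl _ p   → P , P' , ε , p , refl }
    ; c2e  = λ { P _ _ refl s        → P , ε , s }
    }

  record IsTransfer (ℛ : Rel₂ L) : Set₁ where
    field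
      c1a : ∀ P Q α P' → R₀ ℛ P Q → α ≢ t → P ⟶[ α ] P' →
            ∃[ Q₁ ] ∃[ Q₂ ] (Q ⟹ Q₁ × Q₁ ⟶⦅ α ⦆ Q₂ × R₀ ℛ P Q₁ × R₀ ℛ P' Q₂)
      c1b : ∀ P Q → R₀ ℛ P Q → ∀ Y → R₁ ℛ P Y Q
      c2a : ∀ P X Q P' → R₁ ℛ P X Q → P ⟶[ τ ] P' →
            ∃[ Q₁ ] ∃[ Q₂ ] (Q ⟹ Q₁ × Q₁ ⟶⦅ τ ⦆ Q₂ × R₁ ℛ P X Q₁ × R₁ ℛ P' X Q₂)
      c2b : ∀ P X Q a P' → R₁ ℛ P X Q → X a → P ⟶[ vis a ] P' →
            ∃[ Q₁ ] ∃[ Q₂ ] (Q ⟹ Q₁ × Q₁ ⟶[ vis a ] Q₂ × R₁ ℛ P X Q₁ × R₀ ℛ P' Q₂)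
      c2c : ∀ P X Q → R₁ ℛ P X Q → NoInitIn X P → ∃[ Q₀ ] (Q ⟹ Q₀ × R₀ ℛ P Q₀)
      c2d : ∀ P X Q P' → R₁ ℛ P X Q → NoInitIn X P → P ⟶[ t ] P' →
            ∃[ Q₁ ] ∃[ Q₂ ] (Q ⟹ Q₁ × Q₁ ⟶[ t ] Q₂ × R₁ ℛ P' X Q₂)
      c2e : ∀ P X Q → R₁ ℛ P X Q → Stable P → ∃[ Q₀ ] (Q ⟹ Q₀ × Stable Q₀)

  module CBRBProperties {ℛ : Rel₂ L} (isℛ : IsCBRB L ℛ) where
    open IsCBRB isℛ

    R₀-simulates-⟹ : ∀ {M M' Q} → R₀ ℛ M Q → M ⟹ M' → ∃[ Q' ] (Q ⟹ Q' × R₀ ℛ M' Q')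
    R₀-simulates-⟹ r ε = _ , ε , r
    R₀-simulates-⟹ r (p ◅ ps) with c1a _ _ τ _ r τ≢t p
    ... | _ , _ , q , q₁ , _ , r' with R₀-simulates-⟹ r' ps
    ... | Q' , qs , r'' = Q' , ⟹-⟶⦅τ⦆ q q₁ ◅◅ qs , r''

    R₁-simulates-⟹ : ∀ {M M' X Q} → R₁ ℛ M X Q → M ⟹ M' → ∃[ Q' ] (Q ⟹ Q' × R₁ ℛ M' X Q')
    R₁-simulates-⟹ r ε = _ , ε , r
    R₁-simulates-⟹ r (p ◅ ps) with c2a _ _ _ _ r p
    ... | _ , _ , q , q₁ , _ , r' with R₁-simulates-⟹ r' ps
    ... | Q' , qs , r'' = Q' , ⟹-⟶⦅τ⦆ q q₁ ◅◅ qs , r''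

    -- The stable P can only answer M's τ-steps by idling.
    R₀-stable-⟹ʳ : ∀ {P M M'} → R₀ ℛ P M → Stable P → M ⟹ M' → R₀ ℛ P M'
    R₀-stable-⟹ʳ r s ε = r
    R₀-stable-⟹ʳ r s (p ◅ ps) with c1a _ _ τ _ (sym₀ _ _ r) τ≢t p
    ... | _ , _ , q , q₁ , _ , r' with Stable⇒⟹-≡ s q
    ... | refl with Stable⇒⟶⦅τ⦆-≡ s q₁
    ... | refl = R₀-stable-⟹ʳ (sym₀ _ _ r') s ps

    NoInitIn-R₀ : ∀ {P M X} → R₀ ℛ P M → NoInitIn X P → Stable M → NoInitIn X M
    NoInitIn-R₀ r (sP , noX) sM = sM , λ a M' Xa p →
      let _ , P' , q , q₁ , _ = c1a _ _ (vis a) M' (sym₀ _ _ r) (λ ()) p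
      in noX a P' Xa (subst (_⟶[ vis a ] P') (sym (Stable⇒⟹-≡ sP q)) (⟶⦅vis⦆⇒⟶ q₁))

    stable-R₀-partner : ∀ {P M X} → R₁ ℛ P X M → NoInitIn X P →
                        ∃[ M' ] (M ⟹ M' × R₀ ℛ P M' × Stable M')
    stable-R₀-partner {P} {M} {X} r ni@(sP , _) with c2c P X M r ni
    ... | M₀ , m₀ , r₀ with c2e P X M₀ (c1b P M₀ r₀ X) sP
    ... | M' , m , sM' = M' , m₀ ◅◅ m , R₀-stable-⟹ʳ r₀ sP m , sM'

  infixr 7 _⨾_
  infixr 6 _∪_

  _⨾_ : Rel₂ L → Rel₂ L → Rel₂ L
  ℛ ⨾ 𝒮 = record { R₀ = λ P Q → ∃[ M ] (R₀ ℛ P M × R₀ 𝒮 M Q)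
                 ; R₁ = λ P X Q → ∃[ M ] (R₁ ℛ P X M × R₁ 𝒮 M X Q) }

  _∪_ : Rel₂ L → Rel₂ L → Rel₂ L
  ℛ ∪ 𝒮 = record { R₀ = λ P Q → R₀ ℛ P Q ⊎ R₀ 𝒮 P Q
                 ; R₁ = λ P X Q → R₁ ℛ P X Q ⊎ R₁ 𝒮 P X Q }

  ⨾-isTransfer : ∀ {ℛ 𝒮} → IsCBRB L ℛ → IsCBRB L 𝒮 → IsTransfer (ℛ ⨾ 𝒮)
  ⨾-isTransfer {ℛ} {𝒮} isℛ is𝒮 = record
    { c1a = c1a ; c1b = c1b ; c2a = c2a ; c2b = c2b ; c2c = c2c ; c2d = c2d ; c2e = c2e }
    where
    module ℛ = IsCBRB isℛ
    module 𝒮 = IsCBRB is𝒮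
    open CBRBProperties isℛ using (stable-R₀-partner; NoInitIn-R₀)
    open CBRBProperties is𝒮 using (R₀-simulates-⟹; R₁-simulates-⟹)
    𝒞 = ℛ ⨾ 𝒮

    c1a : ∀ P Q α P' → R₀ 𝒞 P Q → α ≢ t → P ⟶[ α ] P' →
          ∃[ Q₁ ] ∃[ Q₂ ] (Q ⟹ Q₁ × Q₁ ⟶⦅ α ⦆ Q₂ × R₀ 𝒞 P Q₁ × R₀ 𝒞 P' Q₂)
    c1a P Q α P' (M , r , s) α≢t p with ℛ.c1a P M α P' r α≢t p
    ... | M₁ , M₂ , m , m₁ , r₁ , r₂ with R₀-simulates-⟹ s m
    c1a P Q α P' (M , r , s) α≢t p
        | M₁ , .M₁ , m , inj₁ (refl , refl) , r₁ , r₂ | Q' , q , s' =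
      Q' , Q' , q , inj₁ (refl , refl) , (M₁ , r₁ , s') , (M₁ , r₂ , s')
    c1a P Q α P' (M , r , s) α≢t p
        | M₁ , M₂ , m , inj₂ m₁ , r₁ , r₂ | Q' , q , s'
        with 𝒮.c1a M₁ Q' α M₂ s' α≢t m₁
    ... | Q₁ , Q₂ , q' , q₁ , s₁ , s₂ = Q₁ , Q₂ , q ◅◅ q' , q₁ , (M₁ , r₁ , s₁) , (M₂ , r₂ , s₂)

    c1b : ∀ P Q → R₀ 𝒞 P Q → ∀ Y → R₁ 𝒞 P Y Q
    c1b P Q (M , r , s) Y = M , ℛ.c1b P M r Y , 𝒮.c1b M Q s Y

    c2a : ∀ P X Q P' → R₁ 𝒞 P X Q → P ⟶[ τ ] P' →
          ∃[ Q₁ ] ∃[ Q₂ ] (Q ⟹ Q₁ × Q₁ ⟶⦅ τ ⦆ Q₂ × R₁ 𝒞 P X Q₁ × R₁ 𝒞 P' X Q₂)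
    c2a P X Q P' (M , r , s) p with ℛ.c2a P X M P' r p
    ... | M₁ , M₂ , m , m₁ , r₁ , r₂ with R₁-simulates-⟹ s m
    c2a P X Q P' (M , r , s) p
        | M₁ , .M₁ , m , inj₁ (_ , refl) , r₁ , r₂ | Q' , q , s' =
      Q' , Q' , q , inj₁ (refl , refl) , (M₁ , r₁ , s') , (M₁ , r₂ , s')
    c2a P X Q P' (M , r , s) p
        | M₁ , M₂ , m , inj₂ m₁ , r₁ , r₂ | Q' , q , s'
        with 𝒮.c2a M₁ X Q' M₂ s' m₁
    ... | Q₁ , Q₂ , q' , q₁ , s₁ , s₂ = Q₁ , Q₂ , q ◅◅ q' , q₁ , (M₁ , r₁ , s₁) , (M₂ , r₂ , s₂)

    c2b : ∀ P X Q a P' → R₁ 𝒞 P X Q → X a → P ⟶[ vis a ] P' →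
          ∃[ Q₁ ] ∃[ Q₂ ] (Q ⟹ Q₁ × Q₁ ⟶[ vis a ] Q₂ × R₁ 𝒞 P X Q₁ × R₀ 𝒞 P' Q₂)
    c2b P X Q a P' (M , r , s) Xa p with ℛ.c2b P X M a P' r Xa p
    ... | M₁ , M₂ , m , m₁ , r₁ , r₂ with R₁-simulates-⟹ s m
    ... | Q' , q , s' with 𝒮.c2b M₁ X Q' a M₂ s' Xa m₁
    ... | Q₁ , Q₂ , q' , q₁ , s₁ , s₂ = Q₁ , Q₂ , q ◅◅ q' , q₁ , (M₁ , r₁ , s₁) , (M₂ , r₂ , s₂)

    c2c : ∀ P X Q → R₁ 𝒞 P X Q → NoInitIn X P → ∃[ Q₀ ] (Q ⟹ Q₀ × R₀ 𝒞 P Q₀)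
    c2c P X Q (M , r , s) ni with stable-R₀-partner r ni
    ... | M' , m , r' , sM' with R₁-simulates-⟹ s m
    ... | Q' , q , s' with 𝒮.c2c M' X Q' s' (NoInitIn-R₀ r' ni sM')
    ... | Q₀ , q' , s₀ = Q₀ , q ◅◅ q' , (M' , r' , s₀)

    c2d : ∀ P X Q P' → R₁ 𝒞 P X Q → NoInitIn X P → P ⟶[ t ] P' →
          ∃[ Q₁ ] ∃[ Q₂ ] (Q ⟹ Q₁ × Q₁ ⟶[ t ] Q₂ × R₁ 𝒞 P' X Q₂)
    c2d P X Q P' (M , r , s) ni p with stable-R₀-partner r ni
    ... | M' , m , r' , sM' with ℛ.c2d P X M' P' (ℛ.c1b P M' r' X) ni p
    ... | M₁ , M₂ , m' , m₁ , r₂ with Stable⇒⟹-≡ sM' m'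
    ... | refl with R₁-simulates-⟹ s m
    ... | Q' , q , s' with 𝒮.c2d M' X Q' M₂ s' (NoInitIn-R₀ r' ni sM') m₁
    ... | Q₁ , Q₂ , q' , q₁ , s₂ = Q₁ , Q₂ , q ◅◅ q' , q₁ , (M₂ , r₂ , s₂)

    c2e : ∀ P X Q → R₁ 𝒞 P X Q → Stable P → ∃[ Q₀ ] (Q ⟹ Q₀ × Stable Q₀)
    c2e P X Q (M , r , s) sP with ℛ.c2e P X M r sP
    ... | M' , m , sM' with R₁-simulates-⟹ s m
    ... | Q' , q , s' with 𝒮.c2e M' X Q' s' sM'
    ... | Q₀ , q' , sQ₀ = Q₀ , q ◅◅ q' , sQ₀

  ∪-isTransfer : ∀ {ℛ 𝒮} → IsTransfer ℛ → IsTransfer 𝒮 → IsTransfer (ℛ ∪ 𝒮)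
  ∪-isTransfer {ℛ} {𝒮} isℛ is𝒮 = record
    { c1a = c1a ; c1b = c1b ; c2a = c2a ; c2b = c2b ; c2c = c2c ; c2d = c2d ; c2e = c2e }
    where
    module ℛ = IsTransfer isℛ
    module 𝒮 = IsTransfer is𝒮
    𝒰 = ℛ ∪ 𝒮

    c1a : ∀ P Q α P' → R₀ 𝒰 P Q → α ≢ t → P ⟶[ α ] P' →
          ∃[ Q₁ ] ∃[ Q₂ ] (Q ⟹ Q₁ × Q₁ ⟶⦅ α ⦆ Q₂ × R₀ 𝒰 P Q₁ × R₀ 𝒰 P' Q₂)
    c1a P Q α P' (inj₁ r) α≢t p with ℛ.c1a P Q α P' r α≢t p
    ... | Q₁ , Q₂ , q , q₁ , r₁ , r₂ = Q₁ , Q₂ , q , q₁ , inj₁ r₁ , inj₁ r₂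
    c1a P Q α P' (inj₂ s) α≢t p with 𝒮.c1a P Q α P' s α≢t p
    ... | Q₁ , Q₂ , q , q₁ , s₁ , s₂ = Q₁ , Q₂ , q , q₁ , inj₂ s₁ , inj₂ s₂

    c1b : ∀ P Q → R₀ 𝒰 P Q → ∀ Y → R₁ 𝒰 P Y Q
    c1b P Q (inj₁ r) Y = inj₁ (ℛ.c1b P Q r Y)
    c1b P Q (inj₂ s) Y = inj₂ (𝒮.c1b P Q s Y)

    c2a : ∀ P X Q P' → R₁ 𝒰 P X Q → P ⟶[ τ ] P' →
          ∃[ Q₁ ] ∃[ Q₂ ] (Q ⟹ Q₁ × Q₁ ⟶⦅ τ ⦆ Q₂ × R₁ 𝒰 P X Q₁ × R₁ 𝒰 P' X Q₂)
    c2a P X Q P' (inj₁ r) p with ℛ.c2a P X Q P' r p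
    ... | Q₁ , Q₂ , q , q₁ , r₁ , r₂ = Q₁ , Q₂ , q , q₁ , inj₁ r₁ , inj₁ r₂
    c2a P X Q P' (inj₂ s) p with 𝒮.c2a P X Q P' s p
    ... | Q₁ , Q₂ , q , q₁ , s₁ , s₂ = Q₁ , Q₂ , q , q₁ , inj₂ s₁ , inj₂ s₂

    c2b : ∀ P X Q a P' → R₁ 𝒰 P X Q → X a → P ⟶[ vis a ] P' →
          ∃[ Q₁ ] ∃[ Q₂ ] (Q ⟹ Q₁ × Q₁ ⟶[ vis a ] Q₂ × R₁ 𝒰 P X Q₁ × R₀ 𝒰 P' Q₂)
    c2b P X Q a P' (inj₁ r) Xa p with ℛ.c2b P X Q a P' r Xa p
    ... | Q₁ , Q₂ , q , q₁ , r₁ , r₂ = Q₁ , Q₂ , q , q₁ , inj₁ r₁ , inj₁ r₂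
    c2b P X Q a P' (inj₂ s) Xa p with 𝒮.c2b P X Q a P' s Xa p
    ... | Q₁ , Q₂ , q , q₁ , s₁ , s₂ = Q₁ , Q₂ , q , q₁ , inj₂ s₁ , inj₂ s₂

    c2c : ∀ P X Q → R₁ 𝒰 P X Q → NoInitIn X P → ∃[ Q₀ ] (Q ⟹ Q₀ × R₀ 𝒰 P Q₀)
    c2c P X Q (inj₁ r) ni with ℛ.c2c P X Q r ni
    ... | Q₀ , q , r₀ = Q₀ , q , inj₁ r₀
    c2c P X Q (inj₂ s) ni with 𝒮.c2c P X Q s ni
    ... | Q₀ , q , s₀ = Q₀ , q , inj₂ s₀

    c2d : ∀ P X Q P' → R₁ 𝒰 P X Q → NoInitIn X P → P ⟶[ t ] P' →
          ∃[ Q₁ ] ∃[ Q₂ ] (Q ⟹ Q₁ × Q₁ ⟶[ t ] Q₂ × R₁ 𝒰 P' X Q₂)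
    c2d P X Q P' (inj₁ r) ni p with ℛ.c2d P X Q P' r ni p
    ... | Q₁ , Q₂ , q , q₁ , r₂ = Q₁ , Q₂ , q , q₁ , inj₁ r₂
    c2d P X Q P' (inj₂ s) ni p with 𝒮.c2d P X Q P' s ni p
    ... | Q₁ , Q₂ , q , q₁ , s₂ = Q₁ , Q₂ , q , q₁ , inj₂ s₂

    c2e : ∀ P X Q → R₁ 𝒰 P X Q → Stable P → ∃[ Q₀ ] (Q ⟹ Q₀ × Stable Q₀)
    c2e P X Q (inj₁ r) = ℛ.c2e P X Q r
    c2e P X Q (inj₂ s) = 𝒮.c2e P X Q s

  ⨾-∪-⨾-isCBRB : ∀ {ℛ 𝒮} → IsCBRB L ℛ → IsCBRB L 𝒮 → IsCBRB L (ℛ ⨾ 𝒮 ∪ 𝒮 ⨾ ℛ)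
  ⨾-∪-⨾-isCBRB isℛ is𝒮 = record
    { sym₀ = λ { _ _ (inj₁ (M , r , s)) → inj₂ (M , 𝒮.sym₀ _ _ s , ℛ.sym₀ _ _ r)
               ; _ _ (inj₂ (M , s , r)) → inj₁ (M , ℛ.sym₀ _ _ r , 𝒮.sym₀ _ _ s) }
    ; sym₁ = λ { _ _ _ (inj₁ (M , r , s)) → inj₂ (M , 𝒮.sym₁ _ _ _ s , ℛ.sym₁ _ _ _ r)
               ; _ _ _ (inj₂ (M , s , r)) → inj₁ (M , ℛ.sym₁ _ _ _ r , 𝒮.sym₁ _ _ _ s) }
    ; c1a = c1a ; c1b = c1b ; c2a = c2a ; c2b = c2b ; c2c = c2c ; c2d = c2d ; c2e = c2e
    }
    where
    module ℛ = IsCBRB isℛ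
    module 𝒮 = IsCBRB is𝒮
    open IsTransfer (∪-isTransfer (⨾-isTransfer isℛ is𝒮) (⨾-isTransfer is𝒮 isℛ))

  ≃br-isEquivalence : IsEquivalence (_≃br_ L)
  ≃br-isEquivalence = record
    { refl  = _ , ≡-isCBRB , refl
    ; sym   = λ (ℛ , isℛ , r) → ℛ , isℛ , IsCBRB.sym₀ isℛ _ _ r
    ; trans = λ (ℛ , isℛ , r) (𝒮 , is𝒮 , s) → ℛ ⨾ 𝒮 ∪ 𝒮 ⨾ ℛ , ⨾-∪-⨾-isCBRB isℛ is𝒮 , inj₁ (_ , r , s)
    }

  ≃br[]-isEquivalence : ∀ X → IsEquivalence (λ P Q → _≃br[_]_ L P X Q)
  ≃br[]-isEquivalence X = record
    { refl  = _ , ≡-isCBRB , refl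
    ; sym   = λ (ℛ , isℛ , r) → ℛ , isℛ , IsCBRB.sym₁ isℛ _ _ _ r
    ; trans = λ (ℛ , isℛ , r) (𝒮 , is𝒮 , s) → ℛ ⨾ 𝒮 ∪ 𝒮 ⨾ ℛ , ⨾-∪-⨾-isCBRB isℛ is𝒮 , inj₁ (_ , r , s)
    }

proposition4 : (L : LTS) →
    IsEquivalence (_≃br_ L) × (∀ (X : Subset L) → IsEquivalence (λ P Q → _≃br[_]_ L P X Q))
proposition4 L = ≃br-isEquivalence L , ≃br[]-isEquivalence L
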